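{- Let $G$ be a finite simple graph with vertex set $[n]$, and order the edges of $G$ lexicographically. Then for each $m\ge 0$, $\mathcal{ISF}_m(G)\subseteq \mathcal{NBC}_m(G)$. Moreover, the following are equivalent: (a) $\mathcal{ISF}_m(G)=\mathcal{NBC}_m(G)$ for all $m\ge0$; (b) $\mathcal{ISF}_2(G)=\mathcal{NBC}_2(G)$; (c) the natural ordering $1,2,\dots,n$ is a perfect elimination ordering of $G$.
   Context: Edges are written $ij$ with $i<j$ and ordered lexicographically as pairs $(i,j)$. A labeled tree is rooted at its smallest vertex and is increasing if labels increase along every path from the root; an increasing spanning forest (ISF) of $G$ is an edge set of $G$ forming a forest all of whose components are increasing. $\mathcal{ISF}_m(G)$ is the set of ISFs with $m$ edges. A broken circuit is the edge set of a cycle of $G$ with its smallest edge removed; an NBC set is an edge set containing no broken circuit; $\mathcal{NBC}_m(G)$ is the set of NBC sets with $m$ edges. The ordering $1,\dots,n$ is a perfect elimination ordering (PEO) if for all $i<j<k$, $ik,jk\in E(G)$ implies $ij\in E(G)$. -}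

module Defs where

open import Data.Nat using (ℕ; zero; suc; _+_; _≤_)
open import Data.Fin using (Fin) renaming (_<_ to _<ᶠ_; _<?_ to _<ᶠ?_)
open import Data.Bool using (Bool; true; false; if_then_else_)
open import Data.List using (List; []; _∷_; _++_; length; map)
open import Data.List.Relation.Unary.All using (All)
open import Data.List.Relation.Unary.Unique.Propositional using (Unique)
open import Data.List.Membership.Propositional using (_∈_)
open import Data.Product using (Σ; _×_; _,_; uncurry)
open import Data.Sum using (_⊎_)
open import Relation.Nullary using (¬_; yes; no)
open import Relation.Binary.PropositionalEquality using (_≡_; _≢_)
open import Relation.Binary.Construct.Closure.ReflexiveTransitive using (Star)
open import Function.Bundles using (_⇔_)

record Graph (n : ℕ) : Set where
  field
    adj    : Fin n → Fin n → Bool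
    sym    : ∀ i j → adj i j ≡ adj j i
    irrefl : ∀ i → adj i i ≡ false

open Graph public

Adj : ∀ {n} → Graph n → Fin n → Fin n → Set
Adj G u v = adj G u v ≡ true

-- An edge ij (i < j) is represented as the pair (i , j).
Edge : ℕ → Set
Edge n = Fin n × Fin n

edge : ∀ {n} → Fin n → Fin n → Edge n
edge u v with u <ᶠ? v
... | yes _ = (u , v)
... | no _  = (v , u)

_<lex_ : ∀ {n} → Edge n → Edge n → Set
(i , j) <lex (k , l) = (i <ᶠ k) ⊎ (i ≡ k × j <ᶠ l)

_≤lex_ : ∀ {n} → Edge n → Edge n → Set
e ≤lex f = (e ≡ f) ⊎ (e <lex f)

EdgeSet : ℕ → Set
EdgeSet n = Fin n → Fin n → Bool

_∈E_ : ∀ {n} → Edge n → EdgeSet n → Set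
(i , j) ∈E S = S i j ≡ true

EdgeSetOf : ∀ {n} → Graph n → EdgeSet n → Set
EdgeSetOf G S = ∀ i j → S i j ≡ true → (i <ᶠ j) × Adj G i j

AdjS : ∀ {n} → EdgeSet n → Fin n → Fin n → Set
AdjS S u v = ((u , v) ∈E S) ⊎ ((v , u) ∈E S)

sumFin : ∀ n → (Fin n → ℕ) → ℕ
sumFin zero    f = 0
sumFin (suc n) f = f Data.Fin.zero + sumFin n (λ i → f (Data.Fin.suc i))

card : ∀ {n} → EdgeSet n → ℕ
card {n} S = sumFin n (λ i → sumFin n (λ j → if S i j then 1 else 0))

consec : ∀ {A : Set} → List A → List (A × A)
consec []           = []
consec (x ∷ [])     = []
consec (x ∷ y ∷ xs) = (x , y) ∷ consec (y ∷ xs)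

closedPairs : ∀ {A : Set} → List A → List (A × A)
closedPairs []       = []
closedPairs (x ∷ xs) = consec (x ∷ xs ++ x ∷ [])

IsCycle : ∀ {n} → (Fin n → Fin n → Set) → List (Fin n) → Set
IsCycle R vs = (3 ≤ length vs) × Unique vs × All (uncurry R) (closedPairs vs)

cycleEdges : ∀ {n} → List (Fin n) → List (Edge n)
cycleEdges vs = map (uncurry edge) (closedPairs vs)

IsPath : ∀ {n} → (Fin n → Fin n → Set) → List (Fin n) → Set
IsPath R vs = Unique vs × All (uncurry R) (consec vs)

ContainsBC : ∀ {n} → Graph n → EdgeSet n → Set
ContainsBC {n} G S =
  Σ (List (Fin n)) λ vs → IsCycle (Adj G) vs ×
  Σ (Edge n) λ e₀ → (e₀ ∈ cycleEdges vs) ×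
    All (e₀ ≤lex_) (cycleEdges vs) ×
    All (λ e → e ≢ e₀ → e ∈E S) (cycleEdges vs)

NBC : ∀ {n} → Graph n → ℕ → EdgeSet n → Set
NBC G m S = EdgeSetOf G S × ¬ ContainsBC G S × card S ≡ m

IsForest : ∀ {n} → EdgeSet n → Set
IsForest {n} S = ¬ (Σ (List (Fin n)) λ vs → IsCycle (AdjS S) vs)

IsRoot : ∀ {n} → EdgeSet n → Fin n → Set
IsRoot S r = ∀ v → Star (AdjS S) r v → r Data.Fin.≤ v

IsIncreasing : ∀ {n} → EdgeSet n → Set
IsIncreasing {n} S = ∀ (r : Fin n) (vs : List (Fin n)) → IsRoot S r →
  IsPath (AdjS S) (r ∷ vs) → All (uncurry _<ᶠ_) (consec (r ∷ vs))

ISF : ∀ {n} → Graph n → ℕ → EdgeSet n → Set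
ISF G m S = EdgeSetOf G S × IsForest S × IsIncreasing S × card S ≡ m

ISF≡NBC : ∀ {n} → Graph n → ℕ → Set
ISF≡NBC {n} G m = ∀ (S : EdgeSet n) → ISF G m S ⇔ NBC G m S

IsPEO : ∀ {n} → Graph n → Set
IsPEO {n} G = ∀ (i j k : Fin n) → i <ᶠ j → j <ᶠ k →
  Adj G i k → Adj G j k → Adj G i j

module Submission where

-- The pivot is the property NoSmallerPair S: no vertex has two distinct
-- smaller S-neighbours.  For a forest S this is equivalent to being increasing
-- (a descent on a root path gives one; conversely use the root-to-v path).
-- (1) ISF ⊆ NBC: if all edges of a cycle but its lex-smallest e₀ lie in S,
--     then e₀ (being ≤ both edges at the valley) misses the peak, so the peak
--     has two smaller S-neighbours.
-- (2) PEO ⇒ NBC ⊆ ISF: a cycle of an NBC set S would contain a broken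
--     circuit, and a vertex v with smaller S-neighbours a < b spans, by the
--     PEO property, a triangle a b v whose broken circuit {bv, av} lies in S.
-- (3) ISF₂ = NBC₂ ⇒ PEO: for i < j < k with ik, jk ∈ G but ij ∉ G, the set
--     {ik, jk} is NBC of size 2 but not increasing (the path i k j descends).

open import Defs hiding (sym)
open import Data.Nat as ℕ using (ℕ; zero; suc; z≤n; s≤s; _+_; _*_)
import Data.Nat.Properties as ℕP
open import Data.Fin as F using (Fin; toℕ) renaming (_<_ to _<ᶠ_; _≤_ to _≤ᶠ_)
import Data.Fin.Properties as FP
open import Data.Bool using (Bool; true; false; _∧_; _∨_; if_then_else_)
open import Data.Bool.Properties using (∨-zeroʳ)
open import Data.List using (List; []; _∷_; _++_; length; map)
open import Data.List.Properties using (++-assoc)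
open import Data.List.Relation.Unary.All as All using (All; []; _∷_)
import Data.List.Relation.Unary.All.Properties as AllP
open import Data.List.Relation.Unary.Any using (here; there)
open import Data.List.Relation.Unary.AllPairs using ([]; _∷_)
open import Data.List.Relation.Unary.Unique.Propositional using (Unique)
open import Data.List.Membership.Propositional using (_∈_; _∉_)
open import Data.List.Membership.Propositional.Properties
  using (∈-++⁺ˡ; ∈-++⁺ʳ; ∈-++⁻; ∈-∃++; ∈-map⁺; ∈-map⁻)
open import Data.Product as Product using (Σ; _×_; _,_; proj₁; proj₂; uncurry)
open import Data.Product.Properties using (≡-dec)
open import Data.Sum as Sum using (_⊎_; inj₁; inj₂)
open import Data.Empty using (⊥; ⊥-elim)
open import Relation.Nullary using (¬_; Dec; yes; no; does)
open import Relation.Binary using (tri<; tri≈; tri>)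
open import Relation.Binary.PropositionalEquality
  using (_≡_; _≢_; refl; sym; trans; cong; cong₂; subst; module ≡-Reasoning)
open import Relation.Binary.Construct.Closure.ReflexiveTransitive using (Star; ε; _◅_; _◅◅_)
import Relation.Binary.Construct.Closure.ReflexiveTransitive as Star
open import Function using (_∘_)
open import Algebra.Properties.CommutativeSemigroup ℕP.+-commutativeSemigroup using (interchange)
open import Function.Bundles using (_⇔_; Equivalence; mk⇔)

module _ {A : Set} where

  data EndsAt : List A → A → Set where
    ends-here  : ∀ {v} → EndsAt (v ∷ []) v
    ends-there : ∀ {x xs v} → EndsAt xs v → EndsAt (x ∷ xs) v

  last∈ : ∀ {l v} → EndsAt l v → v ∈ l
  last∈ ends-here       = here refl
  last∈ (ends-there e) = there (last∈ e)

  last∈tail : ∀ {x y : A} {ys v} → EndsAt (x ∷ y ∷ ys) v → v ∈ (y ∷ ys)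
  last∈tail (ends-there e) = last∈ e

  lastOf : ∀ x xs → Σ A (EndsAt (x ∷ xs))
  lastOf x []       = x , ends-here
  lastOf x (y ∷ ys) = Product.map₂ ends-there (lastOf y ys)

  consec-∈ : ∀ {l : List A} {p q} → (p , q) ∈ consec l → p ∈ l × q ∈ l
  consec-∈ {x ∷ y ∷ xs} (here refl) = here refl , there (here refl)
  consec-∈ {x ∷ y ∷ xs} (there m)   = Product.map there there (consec-∈ {y ∷ xs} m)

  consec-snoc-All : ∀ {P : A × A → Set} {l v c} → EndsAt l v →
    All P (consec l) → P (v , c) → All P (consec (l ++ c ∷ []))
  consec-snoc-All ends-here _ pc = pc ∷ []
  consec-snoc-All (ends-there {xs = y ∷ ys} e) (px ∷ ps) pc = px ∷ consec-snoc-All e ps pc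

  consec-snoc-∈ : ∀ {l v c} → EndsAt l v → (v , c) ∈ consec (l ++ c ∷ [])
  consec-snoc-∈ ends-here = here refl
  consec-snoc-∈ (ends-there {xs = y ∷ ys} e) = there (consec-snoc-∈ e)

  consec-∷ : ∀ {x : A} {l p} → p ∈ consec l → p ∈ consec (x ∷ l)
  consec-∷ {l = y ∷ ys} m = there m

  consec-++ˡ : ∀ (l : List A) {m p} → p ∈ consec m → p ∈ consec (l ++ m)
  consec-++ˡ []      m∈ = m∈
  consec-++ˡ (x ∷ t) m∈ = consec-∷ (consec-++ˡ t m∈)

  consec-++ʳ : ∀ (l : List A) {c r p} → p ∈ consec (l ++ c ∷ []) → p ∈ consec (l ++ c ∷ r)
  consec-++ʳ (x ∷ [])    (here refl) = here refl
  consec-++ʳ (x ∷ y ∷ t) (here refl) = here refl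
  consec-++ʳ (x ∷ y ∷ t) (there m)   = there (consec-++ʳ (y ∷ t) m)

  unique-snoc : ∀ {l : List A} {c} → Unique l → c ∉ l → Unique (l ++ c ∷ [])
  unique-snoc {[]}     _        _  = [] ∷ []
  unique-snoc {x ∷ xs} (x∉ ∷ u) c∉ =
    AllP.++⁺ x∉ ((λ x≡c → c∉ (here (sym x≡c))) ∷ []) ∷ unique-snoc u (c∉ ∘ there)

  unique-++-disjoint : ∀ (l₁ : List A) {l₂ u w} → Unique (l₁ ++ l₂) → u ∈ l₁ → w ∈ l₂ → u ≢ w
  unique-++-disjoint (x ∷ t) (x∉ ∷ _) (here refl) w∈ = All.lookup x∉ (∈-++⁺ʳ t w∈)
  unique-++-disjoint (x ∷ t) (_ ∷ u)  (there u∈)  w∈ = unique-++-disjoint t u u∈ w∈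

  closedPairs-∈ : ∀ (vs : List A) {p q} → (p , q) ∈ closedPairs vs → p ∈ vs × q ∈ vs
  closedPairs-∈ (x ∷ xs) m = Product.map closed-∈ closed-∈ (consec-∈ {x ∷ xs ++ x ∷ []} m)
    where
    closed-∈ : ∀ {y} → y ∈ (x ∷ xs ++ x ∷ []) → y ∈ (x ∷ xs)
    closed-∈ (here eq) = here eq
    closed-∈ (there m) with ∈-++⁻ xs m
    ... | inj₁ m′          = there m′
    ... | inj₂ (here eq)   = here eq

  minimumBy : (_≼_ : A → A → Set) → (∀ x → x ≼ x) → (∀ x y → x ≼ y ⊎ y ≼ x) →
    (∀ {x y z} → x ≼ y → y ≼ z → x ≼ z) →
    ∀ x xs → Σ A λ m → m ∈ (x ∷ xs) × All (m ≼_) (x ∷ xs)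
  minimumBy _≼_ refl≼ total trans≼ x [] = x , here refl , refl≼ x ∷ []
  minimumBy _≼_ refl≼ total trans≼ x (y ∷ ys) with minimumBy _≼_ refl≼ total trans≼ y ys
  ... | m , m∈ , m≼ with total x m
  ...   | inj₁ x≼m = x , here refl , refl≼ x ∷ All.map (trans≼ x≼m) m≼
  ...   | inj₂ m≼x = m , there m∈ , m≼x ∷ m≼

module _ {n : ℕ} where
  open import Data.List.Membership.DecPropositional (FP._≟_ {n}) using (_∈?_)

  VertexRel : Set₁
  VertexRel = Fin n → Fin n → Set

  record Corner (vs : List (Fin n)) (c : Fin n) : Set where
    constructor corner
    field
      next prev : Fin n
      next≢prev : next ≢ prev
      to-next   : (c , next) ∈ closedPairs vs
      from-prev : (prev , c) ∈ closedPairs vs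

  cycle-corner : ∀ {R : VertexRel} {vs c} → IsCycle R vs → c ∈ vs → Corner vs c
  cycle-corner {vs = x ∷ []}         (s≤s () , _) _
  cycle-corner {vs = x ∷ y ∷ []}     (s≤s (s≤s ()) , _) _
  cycle-corner {vs = x ∷ y ∷ z ∷ zs} (_ , _ ∷ (y∉ ∷ _) , _) (here refl) =
    let p , ends = lastOf z zs in
    corner y p (All.lookup y∉ (last∈ ends)) (here refl)
      (consec-snoc-∈ (ends-there (ends-there ends)))
  cycle-corner {vs = x ∷ xs} cyc (there c∈) with ∈-∃++ c∈
  ... | pre , suf , refl = inner-corner pre suf cyc
    where
    inner-corner : ∀ {R : VertexRel} {x c} pre suf → IsCycle R (x ∷ pre ++ c ∷ suf) →
      Corner (x ∷ pre ++ c ∷ suf) c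
    inner-corner {x = x} {c} pre suf (len , u , _) =
      corner (nextOf suf) prev (next≢prev suf u len ends)
        (onCycle (consec-++ˡ (x ∷ pre) (step-to-next suf)))
        (onCycle (consec-++ʳ (x ∷ pre) (consec-snoc-∈ ends)))
      where
      prev = proj₁ (lastOf x pre)
      ends = proj₂ (lastOf x pre)

      nextOf : List (Fin n) → Fin n
      nextOf []      = x
      nextOf (s ∷ _) = s

      step-to-next : ∀ suf → (c , nextOf suf) ∈ consec (c ∷ suf ++ x ∷ [])
      step-to-next []      = here refl
      step-to-next (_ ∷ _) = here refl

      onCycle : ∀ {p} → p ∈ consec ((x ∷ pre) ++ c ∷ suf ++ x ∷ []) →
        p ∈ closedPairs (x ∷ pre ++ c ∷ suf)
      onCycle {p} = subst (λ L → p ∈ consec (x ∷ L)) (sym (++-assoc pre (c ∷ suf) (x ∷ [])))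

      next≢prev : ∀ {pre p} suf → Unique (x ∷ pre ++ c ∷ suf) →
        3 ℕ.≤ length (x ∷ pre ++ c ∷ suf) → EndsAt (x ∷ pre) p → nextOf suf ≢ p
      next≢prev {[]}    [] _ (s≤s (s≤s ())) _
      next≢prev {_ ∷ _} [] u _ ends =
        unique-++-disjoint (x ∷ []) u (here refl) (∈-++⁺ˡ (last∈tail ends))
      next≢prev {pre} (s ∷ _) u _ ends s≡p =
        unique-++-disjoint (x ∷ pre) u (last∈ ends) (there (here refl)) (sym s≡p)

  PathFrom : VertexRel → Fin n → Fin n → Fin n → Set
  PathFrom R x y v = Σ (List (Fin n)) λ rest →
    IsPath R (x ∷ rest) × EndsAt (x ∷ rest) v × y ∈ (x ∷ rest)

  path-tail : ∀ {R : VertexRel} {x xs} → IsPath R (x ∷ xs) → IsPath R xs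
  path-tail {xs = []}    (_ ∷ u , _)      = u , []
  path-tail {xs = _ ∷ _} (_ ∷ u , _ ∷ st) = u , st

  suffixFrom : ∀ {R : VertexRel} {l x y v} → x ∈ l → y ∈ l → IsPath R l → EndsAt l v →
    PathFrom R x y v ⊎ PathFrom R y x v
  suffixFrom {l = _ ∷ rest} (here refl) y∈ p e = inj₁ (rest , p , e , y∈)
  suffixFrom {l = _ ∷ rest} x∈ (here refl) p e = inj₂ (rest , p , e , x∈)
  suffixFrom (there x∈) (there y∈) p (ends-there e) = suffixFrom x∈ y∈ (path-tail p) e

  star⇒path : ∀ {R : VertexRel} {a b} → Star R a b →
    Σ (List (Fin n)) λ rest → IsPath R (a ∷ rest) × EndsAt (a ∷ rest) b
  star⇒path ε = [] , ([] ∷ [] , []) , ends-here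
  star⇒path {a = a} (_◅_ {j = x} a~x x⇝b) with star⇒path x⇝b
  ... | rest , p , e with a ∈? (x ∷ rest)
  ...   | no a∉ = x ∷ rest , (AllP.¬Any⇒All¬ _ a∉ ∷ proj₁ p , a~x ∷ proj₂ p) , ends-there e
  ...   | yes a∈ with suffixFrom a∈ a∈ p e
  ...     | inj₁ (rest′ , p′ , e′ , _) = rest′ , p′ , e′
  ...     | inj₂ (rest′ , p′ , e′ , _) = rest′ , p′ , e′

  closePath : ∀ {R : VertexRel} {x xs v z} → IsPath R (x ∷ xs) → EndsAt (x ∷ xs) v → R v x →
    z ∈ (x ∷ xs) → z ≢ x → z ≢ v → IsCycle R (x ∷ xs)
  closePath {xs = []} _ _ _ (here refl) z≢x _ = ⊥-elim (z≢x refl)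
  closePath {xs = _ ∷ []} _ (ends-there ends-here) _ (here refl) z≢x _ = ⊥-elim (z≢x refl)
  closePath {xs = _ ∷ []} _ (ends-there ends-here) _ (there (here refl)) _ z≢v = ⊥-elim (z≢v refl)
  closePath {xs = _ ∷ _ ∷ _} (u , st) e v~x _ _ _ =
    s≤s (s≤s (s≤s z≤n)) , u , consec-snoc-All e st v~x

module _ {n : ℕ} where
  open import Data.List.Membership.DecPropositional (FP._≟_ {n}) using (_∈?_)

  NoSmallerPair : EdgeSet n → Set
  NoSmallerPair S = ∀ {v a b} → a ≢ b → a <ᶠ v → b <ᶠ v → AdjS S a v → AdjS S b v → ⊥

  AdjS-sym : ∀ (S : EdgeSet n) {u w} → AdjS S u w → AdjS S w u
  AdjS-sym S = Sum.swap

  -- Every vertex v lies in the component of some root; stated in the form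
  -- needed to refute claims about v, because reachability is not decidable.
  refute-via-root : ∀ (S : EdgeSet n) v →
    (∀ r → Star (AdjS S) r v → IsRoot S r → ⊥) → ⊥
  refute-via-root S v at-root = descend (suc (toℕ v)) v ℕP.≤-refl ε
    where
    -- A vertex r reaching v is either a root or reaches a smaller vertex.
    descend : (k : ℕ) (r : Fin n) → toℕ r ℕ.< k → Star (AdjS S) r v → ⊥
    descend (suc k) r (s≤s r≤k) r⇝v = at-root r r⇝v r-root
      where
      r-root : IsRoot S r
      r-root w r⇝w with w FP.<? r
      ... | yes w<r = ⊥-elim (descend k w (ℕP.<-≤-trans w<r r≤k)
                        (Star.reverse (AdjS-sym S) r⇝w ◅◅ r⇝v))
      ... | no w≮r = ℕP.≮⇒≥ w≮r

  -- Take the root r of v's component and a path from r to v: appending a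
  -- smaller neighbour not on the path breaks monotonicity, and if both lie on
  -- it, the path from the earlier one to v closes a cycle with the later one.
  increasing-forest-no-smaller-pair :
    ∀ {S : EdgeSet n} → IsForest S → IsIncreasing S → NoSmallerPair S
  increasing-forest-no-smaller-pair {S} forest incr {v} {a} {b} a≢b a<v b<v a~v b~v =
    refute-via-root S v from-root
    where
    extend : ∀ {r rest c} → IsRoot S r → IsPath (AdjS S) (r ∷ rest) → EndsAt (r ∷ rest) v →
      c ∉ (r ∷ rest) → AdjS S c v → c <ᶠ v → ⊥
    extend {r} {rest} {c} root (u , st) ends c∉ c~v c<v =
      FP.<-asym c<v (All.lookup
        (incr r (rest ++ c ∷ []) root (unique-snoc u c∉ , consec-snoc-All ends st (AdjS-sym S c~v)))
        (consec-snoc-∈ ends))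

    close : ∀ {x y} → PathFrom (AdjS S) x y v → x ≢ y → y ≢ v → AdjS S x v → ⊥
    close {x} (rest , p , ends , y∈) x≢y y≢v x~v =
      forest (x ∷ rest , closePath p ends (AdjS-sym S x~v) y∈ (x≢y ∘ sym) y≢v)

    from-root : ∀ r → Star (AdjS S) r v → IsRoot S r → ⊥
    from-root r r⇝v root with star⇒path r⇝v
    ... | rest , p , ends with a ∈? (r ∷ rest) | b ∈? (r ∷ rest)
    ...   | no a∉  | _      = extend root p ends a∉ a~v a<v
    ...   | yes _  | no b∉  = extend root p ends b∉ b~v b<v
    ...   | yes a∈ | yes b∈ with suffixFrom a∈ b∈ p ends
    ...     | inj₁ from-a = close from-a a≢b (FP.<⇒≢ b<v) a~v
    ...     | inj₂ from-b = close from-b (a≢b ∘ sym) (FP.<⇒≢ a<v) b~v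

  -- If no vertex has two smaller S-neighbours, every S-path from a root
  -- increases: once a path has gone up from p to c, a next step down to y
  -- would give c the two smaller neighbours p and y.
  increasing-if-no-smaller-pair : ∀ {S : EdgeSet n} → NoSmallerPair S → IsIncreasing S
  increasing-if-no-smaller-pair {S} no-pair r []       _    _ = []
  increasing-if-no-smaller-pair {S} no-pair r (x ∷ xs) root (x∉ ∷ u , r~x ∷ st) =
    r<x ∷ ascend r x r<x xs (x∉ ∷ u) (r~x ∷ st)
    where
    r<x = FP.≤∧≢⇒< (root x (r~x ◅ ε)) (All.head x∉)

    ascend : ∀ p c → p <ᶠ c → ∀ ys → Unique (p ∷ c ∷ ys) →
      All (uncurry (AdjS S)) (consec (p ∷ c ∷ ys)) → All (uncurry _<ᶠ_) (consec (c ∷ ys))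
    ascend p c p<c []       _ _ = []
    ascend p c p<c (y ∷ ys) ((_ ∷ p≢y ∷ _) ∷ (c≢y ∷ u) ∷ us) (p~c ∷ c~y ∷ st) with FP.<-cmp c y
    ... | tri< c<y _ _ = c<y ∷ ascend c y c<y ys ((c≢y ∷ u) ∷ us) (c~y ∷ st)
    ... | tri≈ _ c≡y _ = ⊥-elim (c≢y c≡y)
    ... | tri> _ _ y<c = ⊥-elim (no-pair p≢y p<c y<c p~c (AdjS-sym S c~y))

module _ {n : ℕ} where

  edge-< : ∀ {u w : Fin n} → u <ᶠ w → edge u w ≡ (u , w)
  edge-< {u} {w} u<w with u F.<? w
  ... | yes _   = refl
  ... | no u≮w = ⊥-elim (u≮w u<w)

  edge-> : ∀ {u w : Fin n} → w <ᶠ u → edge u w ≡ (w , u)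
  edge-> {u} {w} w<u with u F.<? w
  ... | yes u<w = ⊥-elim (FP.<-asym u<w w<u)
  ... | no _    = refl

  edge-either : ∀ (u w : Fin n) → edge u w ≡ (u , w) ⊎ edge u w ≡ (w , u)
  edge-either u w with u F.<? w
  ... | yes _ = inj₁ refl
  ... | no _  = inj₂ refl

  corner-edges-differ : ∀ {a b c : Fin n} → a ≢ b → edge c a ≢ edge b c
  corner-edges-differ {a} {b} {c} a≢b ca≡bc = differ (edge-either c a) (edge-either b c)
    where
    differ : edge c a ≡ (c , a) ⊎ edge c a ≡ (a , c) → edge b c ≡ (b , c) ⊎ edge b c ≡ (c , b) → ⊥
    differ (inj₁ e₁) (inj₁ e₂) with trans (sym e₁) (trans ca≡bc e₂)
    ... | refl = a≢b refl
    differ (inj₁ e₁) (inj₂ e₂) with trans (sym e₁) (trans ca≡bc e₂)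
    ... | refl = a≢b refl
    differ (inj₂ e₁) (inj₁ e₂) with trans (sym e₁) (trans ca≡bc e₂)
    ... | refl = a≢b refl
    differ (inj₂ e₁) (inj₂ e₂) with trans (sym e₁) (trans ca≡bc e₂)
    ... | refl = a≢b refl

  ≤lex-total : ∀ (e f : Edge n) → e ≤lex f ⊎ f ≤lex e
  ≤lex-total (i , j) (k , l) with FP.<-cmp i k
  ... | tri< i<k _ _ = inj₁ (inj₂ (inj₁ i<k))
  ... | tri> _ _ k<i = inj₂ (inj₂ (inj₁ k<i))
  ... | tri≈ _ refl _ with FP.<-cmp j l
  ...   | tri< j<l _ _  = inj₁ (inj₂ (inj₂ (refl , j<l)))
  ...   | tri≈ _ refl _ = inj₁ (inj₁ refl)
  ...   | tri> _ _ l<j  = inj₂ (inj₂ (inj₂ (refl , l<j)))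

  ≤lex-trans : ∀ {e f g : Edge n} → e ≤lex f → f ≤lex g → e ≤lex g
  ≤lex-trans (inj₁ refl) f≤g = f≤g
  ≤lex-trans e≤f (inj₁ refl) = e≤f
  ≤lex-trans (inj₂ (inj₁ a)) (inj₂ (inj₁ b))               = inj₂ (inj₁ (FP.<-trans a b))
  ≤lex-trans (inj₂ (inj₁ a)) (inj₂ (inj₂ (refl , _)))      = inj₂ (inj₁ a)
  ≤lex-trans (inj₂ (inj₂ (refl , _))) (inj₂ (inj₁ b))      = inj₂ (inj₁ b)
  ≤lex-trans (inj₂ (inj₂ (refl , a))) (inj₂ (inj₂ (refl , b))) = inj₂ (inj₂ (refl , FP.<-trans a b))

  ≤lex-squeeze : ∀ {w v m c : Fin n} → m ≤ᶠ w → c ≤ᶠ v → (w , v) ≤lex (m , c) → v ≡ c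
  ≤lex-squeeze _   _   (inj₁ refl)                = refl
  ≤lex-squeeze m≤w _   (inj₂ (inj₁ w<m))          = ⊥-elim (ℕP.<⇒≱ w<m m≤w)
  ≤lex-squeeze _   c≤v (inj₂ (inj₂ (refl , v<c))) = ⊥-elim (ℕP.<⇒≱ v<c c≤v)

  maximum : ∀ (x : Fin n) xs → Σ (Fin n) λ v → v ∈ (x ∷ xs) × All (_≤ᶠ v) (x ∷ xs)
  maximum = minimumBy (λ a b → b ≤ᶠ a) (λ _ → FP.≤-refl) (λ a b → Sum.swap (FP.≤-total a b))
    (λ b≤a c≤b → FP.≤-trans c≤b b≤a)

  minimum : ∀ (x : Fin n) xs → Σ (Fin n) λ v → v ∈ (x ∷ xs) × All (v ≤ᶠ_) (x ∷ xs)
  minimum = minimumBy _≤ᶠ_ (λ _ → FP.≤-refl) FP.≤-total FP.≤-trans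

  step-edge : ∀ (vs : List (Fin n)) {p q} → (p , q) ∈ closedPairs vs → edge p q ∈ cycleEdges vs
  step-edge _ = ∈-map⁺ (uncurry edge)

module _ {n : ℕ} (G : Graph n) where

  adj-≢ : ∀ {x y} → Adj G x y → x ≢ y
  adj-≢ {x} G-xx refl with trans (sym (irrefl G x)) G-xx
  ... | ()

  step-≢ : ∀ {vs p q} → IsCycle (Adj G) vs → (p , q) ∈ closedPairs vs → p ≢ q
  step-≢ (_ , _ , steps) st = adj-≢ (All.lookup steps st)

  record Peak (vs : List (Fin n)) : Set where
    field
      top    : Fin n
      around : Corner vs top
      ≤top   : All (_≤ᶠ top) vs
    open Corner around public
    field
      next<top : next <ᶠ top
      prev<top : prev <ᶠ top

  record Valley (vs : List (Fin n)) : Set where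
    field
      bottom : Fin n
      around : Corner vs bottom
      bottom≤ : All (bottom ≤ᶠ_) vs
    open Corner around public
    field
      bottom<next : bottom <ᶠ next
      bottom<prev : bottom <ᶠ prev

  peak : ∀ {vs} → IsCycle (Adj G) vs → Peak vs
  peak {vs@(x ∷ xs)} cyc with maximum x xs
  ... | v , v∈ , ≤v = record
    { top = v ; around = around ; ≤top = ≤v
    ; next<top = FP.≤∧≢⇒< (All.lookup ≤v (proj₂ (closedPairs-∈ vs to-next))) (step-≢ cyc to-next ∘ sym)
    ; prev<top = FP.≤∧≢⇒< (All.lookup ≤v (proj₁ (closedPairs-∈ vs from-prev))) (step-≢ cyc from-prev)
    }
    where
    around = cycle-corner cyc v∈
    open Corner around

  valley : ∀ {vs} → IsCycle (Adj G) vs → Valley vs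
  valley {vs@(x ∷ xs)} cyc with minimum x xs
  ... | m , m∈ , m≤ = record
    { bottom = m ; around = around ; bottom≤ = m≤
    ; bottom<next = FP.≤∧≢⇒< (All.lookup m≤ (proj₂ (closedPairs-∈ vs to-next))) (step-≢ cyc to-next)
    ; bottom<prev = FP.≤∧≢⇒< (All.lookup m≤ (proj₁ (closedPairs-∈ vs from-prev))) (step-≢ cyc from-prev ∘ sym)
    }
    where
    around = cycle-corner cyc m∈
    open Corner around

  -- If every edge of a cycle except its lex-smallest edge e₀ lies in S, then
  -- both edges at the peak lie in S: e₀ ≤lex both edges at the valley, which
  -- forces e₀ away from the peak.
  peak-edges-in : ∀ {vs} (cyc : IsCycle (Adj G) vs) (S : EdgeSet n) {e₀} →
    All (e₀ ≤lex_) (cycleEdges vs) → All (λ e → e ≢ e₀ → e ∈E S) (cycleEdges vs) →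
    (P : Peak vs) → (Peak.next P , Peak.top P) ∈E S × (Peak.prev P , Peak.top P) ∈E S
  peak-edges-in {vs} cyc S {e₀} e₀-least others P =
    in-S (subst (_∈ cycleEdges vs) (edge-> next<top) (step-edge vs to-next))
         (not-e₀ (proj₂ (closedPairs-∈ vs to-next))) ,
    in-S (subst (_∈ cycleEdges vs) (edge-< prev<top) (step-edge vs from-prev))
         (not-e₀ (proj₁ (closedPairs-∈ vs from-prev)))
    where
    open Peak P
    module V = Valley (valley cyc)

    in-S : ∀ {e} → e ∈ cycleEdges vs → e ≢ e₀ → e ∈E S
    in-S = All.lookup others

    e₀≤ : ∀ {e} → e ∈ cycleEdges vs → e₀ ≤lex e
    e₀≤ = All.lookup e₀-least

    e₀≤next : e₀ ≤lex (V.bottom , V.next)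
    e₀≤next = e₀≤ (subst (_∈ cycleEdges vs) (edge-< V.bottom<next) (step-edge vs V.to-next))

    e₀≤prev : e₀ ≤lex (V.bottom , V.prev)
    e₀≤prev = e₀≤ (subst (_∈ cycleEdges vs) (edge-> V.bottom<prev) (step-edge vs V.from-prev))

    not-e₀ : ∀ {w} → w ∈ vs → (w , top) ≢ e₀
    not-e₀ w∈ refl = V.next≢prev (trans
      (sym (≤lex-squeeze m≤w (All.lookup ≤top (proj₂ (closedPairs-∈ vs V.to-next))) e₀≤next))
      (≤lex-squeeze m≤w (All.lookup ≤top (proj₁ (closedPairs-∈ vs V.from-prev))) e₀≤prev))
      where m≤w = All.lookup V.bottom≤ w∈

-- (1) Every increasing spanning forest is an NBC set: a broken circuit in S
-- would give the peak of its cycle two distinct smaller S-neighbours.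
isf⇒nbc : ∀ {n} (G : Graph n) m (S : EdgeSet n) → ISF G m S → NBC G m S
isf⇒nbc G m S (edges , forest , incr , size) = edges , no-bc , size
  where
  no-bc : ¬ ContainsBC G S
  no-bc (vs , cyc , e₀ , _ , e₀-least , others) =
    increasing-forest-no-smaller-pair forest incr next≢prev next<top prev<top
      (inj₁ (proj₁ peak-in-S)) (inj₁ (proj₂ peak-in-S))
    where
    P = peak G cyc
    open Peak P
    peak-in-S = peak-edges-in G cyc S e₀-least others P

module _ {n : ℕ} (G : Graph n) {S : EdgeSet n} (edges : EdgeSetOf G S) where

  adjS⇒adj : ∀ {p q} → AdjS S p q → Adj G p q
  adjS⇒adj {p} {q} (inj₁ pq∈) = proj₂ (edges p q pq∈)
  adjS⇒adj {p} {q} (inj₂ qp∈) = trans (Graph.sym G p q) (proj₂ (edges q p qp∈))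

  adjS-oriented : ∀ {p q} → AdjS S p q → p <ᶠ q → (p , q) ∈E S
  adjS-oriented (inj₁ pq∈) _ = pq∈
  adjS-oriented {p} {q} (inj₂ qp∈) p<q = ⊥-elim (FP.<-asym p<q (proj₁ (edges q p qp∈)))

  adjS⇒edge : ∀ {p q} → AdjS S p q → edge p q ∈E S
  adjS⇒edge {p} {q} (inj₁ pq∈) rewrite edge-< (proj₁ (edges p q pq∈)) = pq∈
  adjS⇒edge {p} {q} (inj₂ qp∈) rewrite edge-> (proj₁ (edges q p qp∈)) = qp∈

  -- An NBC set is a forest: a cycle of S is a cycle of G with all its
  -- edges in S, so it contains the broken circuit of that cycle.
  nbc-forest : ¬ ContainsBC G S → IsForest S
  nbc-forest nbc (_ ∷ [] , s≤s () , _)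
  nbc-forest nbc (vs@(x ∷ y ∷ zs) , len , u , steps) =
    nbc (vs , (len , u , All.map adjS⇒adj steps) , e₀ , e₀∈ , e₀-least ,
         All.map (λ e∈S _ → e∈S) all-in-S)
    where
    least = minimumBy _≤lex_ (λ _ → inj₁ refl) ≤lex-total ≤lex-trans
              (edge x y) (map (uncurry edge) (consec (y ∷ zs ++ x ∷ [])))
    e₀ = proj₁ least
    e₀∈ = proj₁ (proj₂ least)
    e₀-least = proj₂ (proj₂ least)

    all-in-S : All (_∈E S) (cycleEdges vs)
    all-in-S = All.tabulate λ e∈ → in-S (∈-map⁻ (uncurry edge) e∈)
      where
      in-S : ∀ {e} → Σ (Edge n) (λ pq → pq ∈ closedPairs vs × e ≡ uncurry edge pq) → e ∈E S
      in-S (_ , st , refl) = adjS⇒edge (All.lookup steps st)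

  -- Under a perfect elimination ordering an NBC set has no vertex v with two
  -- smaller neighbours a < b: then ab ∈ G, and the triangle a b v has
  -- smallest edge ab and broken circuit {bv, av} ⊆ S.
  peo-nbc-no-ordered-pair : IsPEO G → ¬ ContainsBC G S →
    ∀ {a b v} → a <ᶠ b → b <ᶠ v → AdjS S a v → AdjS S b v → ⊥
  peo-nbc-no-ordered-pair peo nbc {a} {b} {v} a<b b<v a~v b~v =
    nbc (a ∷ b ∷ v ∷ [] , cyc , (a , b) , ab∈ , ab-least , others-in-S)
    where
    a<v = FP.<-trans a<b b<v
    G-av = adjS⇒adj a~v
    G-bv = adjS⇒adj b~v

    cyc : IsCycle (Adj G) (a ∷ b ∷ v ∷ [])
    cyc = s≤s (s≤s (s≤s z≤n)) ,
          ((FP.<⇒≢ a<b ∷ FP.<⇒≢ a<v ∷ []) ∷ (FP.<⇒≢ b<v ∷ []) ∷ [] ∷ []) ,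
          (peo a b v a<b b<v G-av G-bv ∷ G-bv ∷ trans (Graph.sym G v a) G-av ∷ [])

    ab∈ : (a , b) ∈ (edge a b ∷ edge b v ∷ edge v a ∷ [])
    ab∈ rewrite edge-< a<b = here refl

    ab-least : All ((a , b) ≤lex_) (edge a b ∷ edge b v ∷ edge v a ∷ [])
    ab-least rewrite edge-< a<b | edge-< b<v | edge-> a<v =
      inj₁ refl ∷ inj₂ (inj₁ a<b) ∷ inj₂ (inj₂ (refl , b<v)) ∷ []

    others-in-S : All (λ e → e ≢ (a , b) → e ∈E S) (edge a b ∷ edge b v ∷ edge v a ∷ [])
    others-in-S rewrite edge-< a<b | edge-< b<v | edge-> a<v =
      (λ ab≢ab → ⊥-elim (ab≢ab refl)) ∷ (λ _ → adjS-oriented b~v b<v) ∷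
      (λ _ → adjS-oriented a~v a<v) ∷ []

  peo-nbc-no-smaller-pair : IsPEO G → ¬ ContainsBC G S → NoSmallerPair S
  peo-nbc-no-smaller-pair peo nbc {v} {a} {b} a≢b a<v b<v a~v b~v with FP.<-cmp a b
  ... | tri< a<b _ _ = peo-nbc-no-ordered-pair peo nbc a<b b<v a~v b~v
  ... | tri≈ _ a≡b _ = a≢b a≡b
  ... | tri> _ _ b<a = peo-nbc-no-ordered-pair peo nbc b<a a<v b~v a~v

nbc⇒isf : ∀ {n} (G : Graph n) → IsPEO G → ∀ m (S : EdgeSet n) → NBC G m S → ISF G m S
nbc⇒isf G peo m S (edges , nbc , size) =
  edges , nbc-forest G edges nbc ,
  increasing-if-no-smaller-pair (peo-nbc-no-smaller-pair G edges peo nbc) , size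

indicator : Bool → ℕ
indicator b = if b then 1 else 0

count : ∀ m → (Fin m → Bool) → ℕ
count m P = sumFin m (indicator ∘ P)

sumFin-cong : ∀ m {f g : Fin m → ℕ} → (∀ x → f x ≡ g x) → sumFin m f ≡ sumFin m g
sumFin-cong zero    _   = refl
sumFin-cong (suc m) f≗g = cong₂ _+_ (f≗g F.zero) (sumFin-cong m (f≗g ∘ F.suc))

sumFin-zero : ∀ m → sumFin m (λ _ → 0) ≡ 0
sumFin-zero zero    = refl
sumFin-zero (suc m) = sumFin-zero m

sumFin-+ : ∀ m (f g : Fin m → ℕ) → sumFin m (λ x → f x + g x) ≡ sumFin m f + sumFin m g
sumFin-+ zero    f g = refl
sumFin-+ (suc m) f g = trans
  (cong (f F.zero + g F.zero +_) (sumFin-+ m (f ∘ F.suc) (g ∘ F.suc)))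
  (interchange (f F.zero) (g F.zero) _ _)

sumFin-*ˡ : ∀ m c (f : Fin m → ℕ) → sumFin m (λ x → c * f x) ≡ c * sumFin m f
sumFin-*ˡ zero    c f = sym (ℕP.*-zeroʳ c)
sumFin-*ˡ (suc m) c f = trans
  (cong (c * f F.zero +_) (sumFin-*ˡ m c (f ∘ F.suc)))
  (sym (ℕP.*-distribˡ-+ c (f F.zero) _))

card-rectangle : ∀ {m} (A B : Fin m → Bool) →
  card (λ p q → A p ∧ B q) ≡ count m A * count m B
card-rectangle {m} A B = begin
  sumFin m (λ p → count m (λ q → A p ∧ B q))   ≡⟨ sumFin-cong m row ⟩
  sumFin m (λ p → count m B * indicator (A p)) ≡⟨ sumFin-*ˡ m (count m B) (indicator ∘ A) ⟩
  count m B * count m A                        ≡⟨ ℕP.*-comm (count m B) (count m A) ⟩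
  count m A * count m B                        ∎
  where
  open ≡-Reasoning
  row : ∀ p → count m (λ q → A p ∧ B q) ≡ count m B * indicator (A p)
  row p with A p
  ... | true  = sym (ℕP.*-identityʳ (count m B))
  ... | false = trans (sumFin-zero m) (sym (ℕP.*-zeroʳ (count m B)))

count-∨ : ∀ {m} (A B : Fin m → Bool) → (∀ x → A x ∧ B x ≡ false) →
  count m (λ x → A x ∨ B x) ≡ count m A + count m B
count-∨ {m} A B disjoint =
  trans (sumFin-cong m pointwise) (sumFin-+ m (indicator ∘ A) (indicator ∘ B))
  where
  pointwise : ∀ x → indicator (A x ∨ B x) ≡ indicator (A x) + indicator (B x)
  pointwise x with A x | B x | disjoint x
  ... | true  | false | _ = refl
  ... | false | true  | _ = refl
  ... | false | false | _ = refl

_==_ : ∀ {m} → Fin m → Fin m → Bool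
x == a = does (x FP.≟ a)

==-refl : ∀ {m} (x : Fin m) → (x == x) ≡ true
==-refl x with x FP.≟ x
... | yes _    = refl
... | no  x≢x = ⊥-elim (x≢x refl)

==-sound : ∀ {m} {x a : Fin m} → (x == a) ≡ true → x ≡ a
==-sound {x = x} {a} x==a with x FP.≟ a
... | yes x≡a = x≡a

count-singleton : ∀ {m} (a : Fin m) → count m (_== a) ≡ 1
count-singleton {suc m} F.zero    = cong suc (sumFin-zero m)
count-singleton {suc m} (F.suc a) = count-singleton a

module PEOViolation {n : ℕ} (G : Graph n) {i j k : Fin n} (i<j : i <ᶠ j) (j<k : j <ᶠ k)
  (G-ik : Adj G i k) (G-jk : Adj G j k) (¬G-ij : ¬ Adj G i j) where

  i<k : i <ᶠ k
  i<k = FP.<-trans i<j j<k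

  S : EdgeSet n
  S p q = (p == i ∨ p == j) ∧ q == k

  data Spanned : Fin n → Set where
    is-i : Spanned i
    is-j : Spanned j
    is-k : Spanned k

  _≟ₑ_ : (e f : Edge n) → Dec (e ≡ f)
  _≟ₑ_ = ≡-dec FP._≟_ FP._≟_

  S-sound : ∀ {p q} → (p , q) ∈E S → (p ≡ i ⊎ p ≡ j) × q ≡ k
  S-sound {p} {q} pq∈ with p == i in p=i | p == j in p=j | q == k in q=k
  ... | true  | _    | true = inj₁ (==-sound p=i) , ==-sound q=k
  ... | false | true | true = inj₂ (==-sound p=j) , ==-sound q=k

  S-edges : EdgeSetOf G S
  S-edges p q pq∈ with S-sound {p} {q} pq∈
  ... | inj₁ refl , refl = i<k , G-ik
  ... | inj₂ refl , refl = j<k , G-jk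

  S-card : card S ≡ 2
  S-card = begin
    card S                                             ≡⟨ card-rectangle (λ p → p == i ∨ p == j) (_== k) ⟩
    count n (λ p → p == i ∨ p == j) * count n (_== k)  ≡⟨ cong₂ _*_ (count-∨ (_== i) (_== j) i≠j) (count-singleton k) ⟩
    (count n (_== i) + count n (_== j)) * 1            ≡⟨ cong (_* 1) (cong₂ _+_ (count-singleton i) (count-singleton j)) ⟩
    2                                                  ∎
    where
    open ≡-Reasoning
    i≠j : ∀ x → (x == i) ∧ (x == j) ≡ false
    i≠j x with x == i in x=i | x == j in x=j
    ... | false | _     = refl
    ... | true  | false = refl
    ... | true  | true  = ⊥-elim (FP.<⇒≢ i<j (trans (sym (==-sound {x = x} x=i)) (==-sound {x = x} x=j)))

  spanned-edge : ∀ u w → edge u w ∈E S → Spanned u × Spanned w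
  spanned-edge u w uw∈ with edge-either u w
  ... | inj₁ e = by-sound (S-sound {u} {w} (subst (_∈E S) e uw∈))
    where
    by-sound : (u ≡ i ⊎ u ≡ j) × w ≡ k → Spanned u × Spanned w
    by-sound (inj₁ refl , refl) = is-i , is-k
    by-sound (inj₂ refl , refl) = is-j , is-k
  ... | inj₂ e = by-sound (S-sound {w} {u} (subst (_∈E S) e uw∈))
    where
    by-sound : (w ≡ i ⊎ w ≡ j) × u ≡ k → Spanned u × Spanned w
    by-sound (inj₁ refl , refl) = is-k , is-i
    by-sound (inj₂ refl , refl) = is-k , is-j

  -- Since ij ∉ G, every G-edge going up inside {i, j, k} ends at k.
  rising-edge-to-k : ∀ {m x} → Spanned m → Spanned x → m <ᶠ x → Adj G m x → x ≡ k
  rising-edge-to-k _    is-k _   _    = refl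
  rising-edge-to-k is-i is-i i<i _    = ⊥-elim (FP.<-irrefl refl i<i)
  rising-edge-to-k is-i is-j _   G-ij = ⊥-elim (¬G-ij G-ij)
  rising-edge-to-k is-j is-i j<i _    = ⊥-elim (FP.<-asym i<j j<i)
  rising-edge-to-k is-j is-j j<j _    = ⊥-elim (FP.<-irrefl refl j<j)
  rising-edge-to-k is-k is-i k<i _    = ⊥-elim (FP.<-asym i<k k<i)
  rising-edge-to-k is-k is-j k<j _    = ⊥-elim (FP.<-asym j<k k<j)

  -- S is an NBC set: in a broken circuit inside S, each vertex has a cycle
  -- edge in S (its two cycle edges differ, so one is not e₀) and hence lies
  -- in {i, j, k}; then the valley of the cycle would have two distinct
  -- larger neighbours, both equal to k.
  S-nbc : ¬ ContainsBC G S
  S-nbc (vs , cyc@(_ , _ , steps) , e₀ , _ , _ , others) =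
    next≢prev (trans (rising-edge-to-k (spanned bottom∈) (spanned next∈) bottom<next G-next)
                     (sym (rising-edge-to-k (spanned bottom∈) (spanned prev∈) bottom<prev G-prev)))
    where
    open Valley (valley G cyc)
    bottom∈ = proj₁ (closedPairs-∈ vs to-next)
    next∈   = proj₂ (closedPairs-∈ vs to-next)
    prev∈   = proj₁ (closedPairs-∈ vs from-prev)
    G-next = All.lookup steps to-next
    G-prev = trans (Graph.sym G bottom prev) (All.lookup steps from-prev)

    spanned : ∀ {c} → c ∈ vs → Spanned c
    spanned c∈ = corner-spanned (cycle-corner cyc c∈)
      where
      corner-spanned : ∀ {c} → Corner vs c → Spanned c
      corner-spanned {c} (corner a b a≢b to-a from-b) with edge c a ≟ₑ e₀
      ... | no ca≢e₀  = proj₁ (spanned-edge c a (All.lookup others (step-edge vs to-a) ca≢e₀))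
      ... | yes ca≡e₀ = proj₂ (spanned-edge b c (All.lookup others (step-edge vs from-b)
                          (λ bc≡e₀ → corner-edges-differ a≢b (trans ca≡e₀ (sym bc≡e₀)))))

  reachable-spanned : ∀ {u w} → Star (AdjS S) u w → w ≡ u ⊎ Spanned w
  reachable-spanned ε = inj₁ refl
  reachable-spanned {u} (_◅_ {j = x} u~x x⇝w) with reachable-spanned x⇝w
  ... | inj₂ w-spanned = inj₂ w-spanned
  ... | inj₁ refl      = inj₂ (end-spanned u~x)
    where
    end-spanned : AdjS S u x → Spanned x
    end-spanned (inj₁ ux∈) with S-sound {u} {x} ux∈
    ... | _ , refl = is-k
    end-spanned (inj₂ xu∈) with S-sound {x} {u} xu∈
    ... | inj₁ refl , _ = is-i
    ... | inj₂ refl , _ = is-j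

  i-root : IsRoot S i
  i-root w i⇝w with reachable-spanned i⇝w
  ... | inj₁ refl = FP.≤-refl
  ... | inj₂ is-i = FP.≤-refl
  ... | inj₂ is-j = ℕP.<⇒≤ i<j
  ... | inj₂ is-k = ℕP.<⇒≤ i<k

  S-not-increasing : ¬ IsIncreasing S
  S-not-increasing incr with incr i (k ∷ j ∷ []) i-root (distinct , steps)
    where
    distinct : Unique (i ∷ k ∷ j ∷ [])
    distinct = (FP.<⇒≢ i<k ∷ FP.<⇒≢ i<j ∷ []) ∷ ((FP.<⇒≢ j<k ∘ sym) ∷ []) ∷ [] ∷ []

    S-ik : (i , k) ∈E S
    S-ik rewrite ==-refl i | ==-refl k = refl

    S-jk : (j , k) ∈E S
    S-jk rewrite ==-refl j | ==-refl k | ∨-zeroʳ (j == i) = refl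

    steps : All (uncurry (AdjS S)) (consec (i ∷ k ∷ j ∷ []))
    steps = inj₁ S-ik ∷ inj₂ S-jk ∷ []
  ... | _ ∷ k<j ∷ [] = FP.<-asym j<k k<j

-- (3) If ISF₂(G) = NBC₂(G), then 1, …, n is a perfect elimination ordering:
-- otherwise the NBC set {ik, jk} of a violation would be an ISF.
isf₂≡nbc₂⇒peo : ∀ {n} (G : Graph n) → ISF≡NBC G 2 → IsPEO G
isf₂≡nbc₂⇒peo G same i j k i<j j<k G-ik G-jk with adj G i j in ij
... | true  = refl
... | false = ⊥-elim (S-not-increasing (proj₁ (proj₂ (proj₂ isf))))
  where
  ¬G-ij : ¬ Adj G i j
  ¬G-ij G-ij with trans (sym ij) G-ij
  ... | ()
  open PEOViolation G i<j j<k G-ik G-jk ¬G-ij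
  isf = Equivalence.from (same S) (S-edges , S-nbc , S-card)

mainTheorem3 : ∀ {n : ℕ} (G : Graph n) →
    (∀ (m : ℕ) (S : EdgeSet n) → ISF G m S → NBC G m S) ×
    (((∀ (m : ℕ) → ISF≡NBC G m) ⇔ ISF≡NBC G 2) × (ISF≡NBC G 2 ⇔ IsPEO G))
mainTheorem3 G =
  isf⇒nbc G ,
  mk⇔ (λ all-m → all-m 2) (peo⇒equal ∘ isf₂≡nbc₂⇒peo G) ,
  mk⇔ (isf₂≡nbc₂⇒peo G) (λ peo → peo⇒equal peo 2)
  where
  peo⇒equal : IsPEO G → ∀ m → ISF≡NBC G m
  peo⇒equal peo m S = mk⇔ (isf⇒nbc G m S) (nbc⇒isf G peo m S)
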